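{- Let $n$ be a positive integer. The generating function for descending plane partitions of order $n$ with no special parts, where each such descending plane partition is weighted by $q$ raised to the sum of its parts, is $$\prod_{i=1}^{n}[i]_{q^i},$$ where $[k]_x=1+x+x^2+\dots+x^{k-1}$.
   Context: A descending plane partition (DPP) is an array of positive integers $\{a_{i,j}\}$ with $i\le j$, placed in shifted shape (row $i$ is indented by $i-1$ units, so row $i$ occupies consecutive positions $(i,i),(i,i+1),\dots$), such that entries weakly decrease along each row, strictly decrease down each column, and for each row the number of parts in that row is strictly less than the largest part in that row and is greater than or equal to the largest part in the next row. The empty array is a DPP. A DPP is of order $n$ if its largest part is at most $n$. A special part of a DPP is an entry $a_{i,j}$ with $a_{i,j}\le j-i$. -}

module Defs where

open import Data.Nat using (ℕ; zero; suc; _+_; _*_; _≤_; _<_; _⊔_; _≟_)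
open import Data.List using (List; []; _∷_; length; map; foldr; upTo; replicate; _++_; filter)
open import Data.List.Relation.Unary.All using (All)
open import Data.List.Relation.Unary.Linked using (Linked)
open import Data.Product using (_×_)
open import Data.Nat.ListAction using (sum)

-- A DPP is represented as its list of rows (top to bottom). Row i (1-indexed)
-- occupies positions (i,i),(i,i+1),..., so the entry a_{i,j} is the element of
-- row i at 0-based index j-i.

data At : List ℕ → ℕ → ℕ → Set where
  here  : ∀ {x r} → At (x ∷ r) zero x
  there : ∀ {y r k x} → At r k x → At (y ∷ r) (suc k) x

maxPart : List ℕ → ℕ
maxPart = foldr _⊔_ 0

record RowOK (r : List ℕ) : Set where
  field
    nonempty      : 0 < length r
    positive      : All (λ x → 1 ≤ x) r
    weaklyDecr    : Linked (λ x y → y ≤ x) r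
    lenLtMax      : length r < maxPart r

record NextRowOK (r r' : List ℕ) : Set where
  field
    shifted       : length r' < length r
    -- column strictness: a_{i+1,j} < a_{i,j}; position j is index k+1 in r
    -- and index k in r'
    colStrict     : ∀ k x y → At r (suc k) x → At r' k y → y < x
    maxNextLeLen  : maxPart r' ≤ length r

IsDPP : List (List ℕ) → Set
IsDPP d = All RowOK d × Linked NextRowOK d

HasOrder : ℕ → List (List ℕ) → Set
HasOrder n d = All (All (λ x → x ≤ n)) d

-- special part: a_{i,j} ≤ j - i, i.e. entry x at 0-based row index k with x ≤ k
NoSpecialParts : List (List ℕ) → Set
NoSpecialParts d = All (λ r → ∀ k x → At r k x → k < x) d

weight : List (List ℕ) → ℕ
weight d = sum (map sum d)

-- Polynomials in q with ℕ coefficients as coefficient lists (constant term first)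
Poly : Set
Poly = List ℕ

_+P_ : Poly → Poly → Poly
[] +P q = q
(a ∷ p) +P [] = a ∷ p
(a ∷ p) +P (b ∷ q) = (a + b) ∷ (p +P q)

_*P_ : Poly → Poly → Poly
[] *P q = []
(a ∷ p) *P q = map (a *_) q +P (0 ∷ (p *P q))

coeff : Poly → ℕ → ℕ
coeff [] _ = 0
coeff (a ∷ p) zero = a
coeff (a ∷ p) (suc k) = coeff p k

monomial : ℕ → Poly
monomial e = replicate e 0 ++ (1 ∷ [])

qBracket : ℕ → ℕ → Poly
qBracket k i = foldr _+P_ [] (map (λ j → monomial (j * i)) (upTo k))

productFormula : ℕ → Poly
productFormula n = foldr (λ i p → qBracket i i *P p) (1 ∷ []) (map suc (upTo n))

countWeight : List (List (List ℕ)) → ℕ → ℕ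
countWeight L k = length (filter (λ d → weight d ≟ k) L)

-- Reading the rows of such a DPP one after another gives a weakly decreasing
-- sequence with parts in [1, n] in which every value i occurs fewer than i
-- times; call these sequences admissible. Conversely, an admissible sequence
-- is cut into rows greedily, continuing a row as long as the next part would
-- not be special there, and the rows obtained form a DPP without special
-- parts. Cutting and concatenating are mutually inverse and preserve the
-- weight. An admissible sequence with parts in [a, a + c) is an admissible
-- sequence with parts in [a + 1, a + c) followed by m < a copies of a, so the
-- weight generating function of these sequences is ∏_{i=a}^{a+c-1} [i]_{q^i}.
module Submission where

open import Defs
open import Data.Nat using (ℕ; zero; suc; pred; _+_; _*_; _∸_; _≤_; _<_; _≟_; _<?_; z≤n; s≤s; >-nonZero)
open import Data.Nat.Properties
open import Data.Bool using (Bool; true; false; if_then_else_)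
open import Data.List using (List; []; _∷_; length; map; foldr; upTo; applyUpTo; replicate; _++_; filter; concat)
open import Data.Nat.ListAction using (sum)
open import Data.Nat.ListAction.Properties using (sum-++)
open import Relation.Nullary using (Dec; does; yes; no; ¬_)
open import Relation.Binary.PropositionalEquality
open import Relation.Binary.Definitions using (tri<; tri≈; tri>)
open import Data.List.Properties using (map-cong; ++-cancelʳ; ++-assoc)
open import Data.List.Relation.Unary.All as All using (All; []; _∷_)
open import Data.List.Relation.Unary.All.Properties using (++⁺; ++⁻ˡ; ++⁻ʳ; replicate⁺; concat⁺; concat⁻)
open import Data.List.Relation.Unary.Linked as Linked using (Linked; []; [-]; _∷_)
open import Data.List.Relation.Unary.Linked.Properties using (Linked⇒AllPairs)
import Data.List.Relation.Unary.AllPairs as AllPairs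
open import Data.List.Membership.Propositional using (_∈_)
open import Data.List.Membership.Propositional.Properties using (∈-map⁺; ∈-map⁻; ∈-++⁺ˡ; ∈-++⁺ʳ; ∈-++⁻; ∈-upTo⁺; ∈-upTo⁻)
open import Data.List.Relation.Unary.Any using (here; there)
open import Data.List.Relation.Unary.Unique.Propositional using (Unique)
open import Data.List.Relation.Unary.AllPairs using ([]; _∷_)
import Data.List.Relation.Unary.Unique.Propositional.Properties as Unique
open import Data.Product using (_×_; _,_; ∃; proj₁; proj₂)
open import Data.Sum using (_⊎_; inj₁; inj₂)
open import Data.Empty using (⊥; ⊥-elim)
open import Data.Unit using (⊤; tt)
open import Function.Bundles using (_⇔_; mk⇔)
open import Algebra.Properties.CommutativeSemigroup +-commutativeSemigroup
  using () renaming (interchange to +-interchange)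

indicator : Bool → ℕ
indicator true = 1
indicator false = 0

countBy : ∀ {A : Set} → (A → ℕ) → ℕ → List A → ℕ
countBy f k xs = length (filter (λ x → f x ≟ k) xs)

countBy-cons : ∀ {A : Set} (f : A → ℕ) k x xs →
  countBy f k (x ∷ xs) ≡ indicator (does (f x ≟ k)) + countBy f k xs
countBy-cons f k x xs with does (f x ≟ k)
... | true = refl
... | false = refl

countBy-++ : ∀ {A : Set} (f : A → ℕ) k xs ys →
  countBy f k (xs ++ ys) ≡ countBy f k xs + countBy f k ys
countBy-++ f k [] ys = refl
countBy-++ f k (x ∷ xs) ys = begin
    countBy f k (x ∷ xs ++ ys)                  ≡⟨ countBy-cons f k x (xs ++ ys) ⟩
    i + countBy f k (xs ++ ys)                  ≡⟨ cong (i +_) (countBy-++ f k xs ys) ⟩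
    i + (countBy f k xs + countBy f k ys)       ≡⟨ sym (+-assoc i _ _) ⟩
    (i + countBy f k xs) + countBy f k ys       ≡⟨ cong (_+ _) (sym (countBy-cons f k x xs)) ⟩
    countBy f k (x ∷ xs) + countBy f k ys       ∎
  where
  open ≡-Reasoning
  i = indicator (does (f x ≟ k))

countBy-cong : ∀ {A : Set} {f g : A → ℕ} → (∀ x → f x ≡ g x) →
  ∀ k xs → countBy f k xs ≡ countBy g k xs
countBy-cong {f = f} {g} f≗g k [] = refl
countBy-cong {f = f} {g} f≗g k (x ∷ xs) = begin
    countBy f k (x ∷ xs)
      ≡⟨ countBy-cons f k x xs ⟩
    indicator (does (f x ≟ k)) + countBy f k xs
      ≡⟨ cong₂ (λ y n → indicator (does (y ≟ k)) + n) (f≗g x) (countBy-cong f≗g k xs) ⟩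
    indicator (does (g x ≟ k)) + countBy g k xs
      ≡⟨ sym (countBy-cons g k x xs) ⟩
    countBy g k (x ∷ xs) ∎
  where open ≡-Reasoning

countBy-map : ∀ {A B : Set} (f : B → ℕ) (h : A → B) k xs →
  countBy f k (map h xs) ≡ countBy (λ x → f (h x)) k xs
countBy-map f h k [] = refl
countBy-map f h k (x ∷ xs) = begin
    countBy f k (h x ∷ map h xs)
      ≡⟨ countBy-cons f k (h x) (map h xs) ⟩
    indicator (does (f (h x) ≟ k)) + countBy f k (map h xs)
      ≡⟨ cong (_ +_) (countBy-map f h k xs) ⟩
    indicator (does (f (h x) ≟ k)) + countBy (λ x → f (h x)) k xs
      ≡⟨ sym (countBy-cons (λ x → f (h x)) k x xs) ⟩
    countBy (λ x → f (h x)) k (x ∷ xs) ∎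
  where open ≡-Reasoning

-- shift e F is the coefficient sequence of q^e times the series with coefficients F
shift : ℕ → (ℕ → ℕ) → ℕ → ℕ
shift zero F k = F k
shift (suc e) F zero = 0
shift (suc e) F (suc k) = shift e F k

shift-cong : ∀ e {F G : ℕ → ℕ} → (∀ k → F k ≡ G k) → ∀ k → shift e F k ≡ shift e G k
shift-cong zero F≗G k = F≗G k
shift-cong (suc e) F≗G zero = refl
shift-cong (suc e) F≗G (suc k) = shift-cong e F≗G k

shift-+ : ∀ e (F G : ℕ → ℕ) k → shift e (λ k → F k + G k) k ≡ shift e F k + shift e G k
shift-+ zero F G k = refl
shift-+ (suc e) F G zero = refl
shift-+ (suc e) F G (suc k) = shift-+ e F G k

shift-zero : ∀ e k → shift e (λ _ → 0) k ≡ 0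
shift-zero zero k = refl
shift-zero (suc e) zero = refl
shift-zero (suc e) (suc k) = shift-zero e k

shift-indicator : ∀ e m k → shift e (λ k' → indicator (does (m ≟ k'))) k ≡ indicator (does (e + m ≟ k))
shift-indicator zero m k = refl
shift-indicator (suc e) m zero = refl
shift-indicator (suc e) m (suc k) = shift-indicator e m k

countBy-shift : ∀ {A : Set} (g f : A → ℕ) e → (∀ x → g x ≡ e + f x) →
  ∀ k xs → countBy g k xs ≡ shift e (λ k' → countBy f k' xs) k
countBy-shift g f e g≡e+f k [] = sym (shift-zero e k)
countBy-shift g f e g≡e+f k (x ∷ xs) = begin
    countBy g k (x ∷ xs)
      ≡⟨ countBy-cons g k x xs ⟩
    indicator (does (g x ≟ k)) + countBy g k xs
      ≡⟨ cong₂ _+_ (cong (λ t → indicator (does (t ≟ k))) (g≡e+f x)) (countBy-shift g f e g≡e+f k xs) ⟩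
    indicator (does (e + f x ≟ k)) + shift e (λ k' → countBy f k' xs) k
      ≡⟨ cong (_+ _) (sym (shift-indicator e (f x) k)) ⟩
    shift e (λ k' → indicator (does (f x ≟ k'))) k + shift e (λ k' → countBy f k' xs) k
      ≡⟨ sym (shift-+ e _ _ k) ⟩
    shift e (λ k' → indicator (does (f x ≟ k')) + countBy f k' xs) k
      ≡⟨ shift-cong e (λ k' → sym (countBy-cons f k' x xs)) k ⟩
    shift e (λ k' → countBy f k' (x ∷ xs)) k ∎
  where open ≡-Reasoning

-- The key fact is
-- coeff-geometric*P: multiplying by [a]_{q^a} sums a shifted copies of the
-- coefficient sequence, mirroring the a choices of a multiplicity below a.

coeff-+P : ∀ p q k → coeff (p +P q) k ≡ coeff p k + coeff q k
coeff-+P [] q k = refl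
coeff-+P (a ∷ p) [] k = sym (+-identityʳ _)
coeff-+P (a ∷ p) (b ∷ q) zero = refl
coeff-+P (a ∷ p) (b ∷ q) (suc k) = coeff-+P p q k

coeff-scale : ∀ c q k → coeff (map (c *_) q) k ≡ c * coeff q k
coeff-scale c [] k = sym (*-zeroʳ c)
coeff-scale c (b ∷ q) zero = refl
coeff-scale c (b ∷ q) (suc k) = coeff-scale c q k

coeff-*P-cons : ∀ a p q k → coeff ((a ∷ p) *P q) k ≡ a * coeff q k + coeff (0 ∷ (p *P q)) k
coeff-*P-cons a p q k = trans (coeff-+P (map (a *_) q) (0 ∷ (p *P q)) k) (cong (_+ _) (coeff-scale a q k))

coeff-*P-distribʳ : ∀ p p' q k → coeff ((p +P p') *P q) k ≡ coeff (p *P q) k + coeff (p' *P q) k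
coeff-*P-distribʳ [] p' q k = refl
coeff-*P-distribʳ (a ∷ p) [] q k = sym (+-identityʳ _)
coeff-*P-distribʳ (a ∷ p) (b ∷ p') q k = begin
    coeff (((a + b) ∷ (p +P p')) *P q) k
      ≡⟨ coeff-*P-cons (a + b) (p +P p') q k ⟩
    (a + b) * c + coeff (0 ∷ ((p +P p') *P q)) k
      ≡⟨ cong₂ _+_ (*-distribʳ-+ c a b) (shifted k) ⟩
    (a * c + b * c) + (coeff (0 ∷ (p *P q)) k + coeff (0 ∷ (p' *P q)) k)
      ≡⟨ +-interchange (a * c) (b * c) _ _ ⟩
    (a * c + coeff (0 ∷ (p *P q)) k) + (b * c + coeff (0 ∷ (p' *P q)) k)
      ≡⟨ sym (cong₂ _+_ (coeff-*P-cons a p q k) (coeff-*P-cons b p' q k)) ⟩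
    coeff ((a ∷ p) *P q) k + coeff ((b ∷ p') *P q) k ∎
  where
  open ≡-Reasoning
  c = coeff q k
  shifted : ∀ k → coeff (0 ∷ ((p +P p') *P q)) k ≡ coeff (0 ∷ (p *P q)) k + coeff (0 ∷ (p' *P q)) k
  shifted zero = refl
  shifted (suc k) = coeff-*P-distribʳ p p' q k

coeff-monomial*P : ∀ e P k → coeff (monomial e *P P) k ≡ shift e (coeff P) k
coeff-monomial*P zero P zero = trans (coeff-*P-cons 1 [] P 0) (trans (+-identityʳ _) (*-identityˡ _))
coeff-monomial*P zero P (suc k) = trans (coeff-*P-cons 1 [] P (suc k)) (trans (+-identityʳ _) (*-identityˡ _))
coeff-monomial*P (suc e) P zero = coeff-*P-cons 0 (monomial e) P 0
coeff-monomial*P (suc e) P (suc k) = trans (coeff-*P-cons 0 (monomial e) P (suc k)) (coeff-monomial*P e P k)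

coeff-geometric*P : ∀ v js P k → coeff (foldr _+P_ [] (map (λ j → monomial (j * v)) js) *P P) k
                                 ≡ sum (map (λ j → shift (j * v) (coeff P) k) js)
coeff-geometric*P v [] P k = refl
coeff-geometric*P v (j ∷ js) P k = begin
    coeff ((monomial (j * v) +P rest) *P P) k
      ≡⟨ coeff-*P-distribʳ (monomial (j * v)) rest P k ⟩
    coeff (monomial (j * v) *P P) k + coeff (rest *P P) k
      ≡⟨ cong₂ _+_ (coeff-monomial*P (j * v) P k) (coeff-geometric*P v js P k) ⟩
    shift (j * v) (coeff P) k + sum (map (λ j → shift (j * v) (coeff P) k) js) ∎
  where
  open ≡-Reasoning
  rest = foldr _+P_ [] (map (λ j → monomial (j * v)) js)

Sorted : List ℕ → Set
Sorted = Linked (λ x y → y ≤ x)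

sorted-bounded : ∀ {x xs} → Sorted (x ∷ xs) → All (λ y → y ≤ x) xs
sorted-bounded s = AllPairs.head (Linked⇒AllPairs (λ p q → ≤-trans q p) s)

sorted-cons : ∀ {x ys} → All (λ y → y ≤ x) ys → Sorted ys → Sorted (x ∷ ys)
sorted-cons [] [] = [-]
sorted-cons (p ∷ _) q = p ∷ q

sorted-++ : ∀ {xs ys} → Sorted xs → Sorted ys → All (λ x → All (λ y → y ≤ x) ys) xs →
  Sorted (xs ++ ys)
sorted-++ {[]} _ q _ = q
sorted-++ {x ∷ xs} p q (a ∷ as) =
  sorted-cons (++⁺ (sorted-bounded p) a) (sorted-++ (Linked.tail p) q as)

sorted-replicate : ∀ m v → Sorted (replicate m v)
sorted-replicate zero v = []
sorted-replicate (suc zero) v = [-]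
sorted-replicate (suc (suc m)) v = ≤-refl ∷ sorted-replicate (suc m) v

equal-or-not : ∀ m n → (m ≡ n × does (m ≟ n) ≡ true) ⊎ (m ≢ n × does (m ≟ n) ≡ false)
equal-or-not m n = outcome (m ≟ n)
  where
  outcome : (d : Dec (m ≡ n)) → (m ≡ n × does d ≡ true) ⊎ (m ≢ n × does d ≡ false)
  outcome (yes p) = inj₁ (p , refl)
  outcome (no q) = inj₂ (q , refl)

less-or-not : ∀ k x → (k < x × does (k <? x) ≡ true) ⊎ (¬ k < x × does (k <? x) ≡ false)
less-or-not k x = outcome (k <? x)
  where
  outcome : (d : Dec (k < x)) → (k < x × does d ≡ true) ⊎ (¬ k < x × does d ≡ false)
  outcome (yes p) = inj₁ (p , refl)
  outcome (no q) = inj₂ (q , refl)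

mult : ℕ → List ℕ → ℕ
mult v [] = 0
mult v (x ∷ xs) = indicator (does (x ≟ v)) + mult v xs

mult-++ : ∀ w xs ys → mult w (xs ++ ys) ≡ mult w xs + mult w ys
mult-++ w [] ys = refl
mult-++ w (x ∷ xs) ys =
  trans (cong (_ +_) (mult-++ w xs ys)) (sym (+-assoc (indicator (does (x ≟ w))) _ _))

mult-replicate : ∀ m v → mult v (replicate m v) ≡ m
mult-replicate zero v = refl
mult-replicate (suc m) v with equal-or-not v v
... | inj₁ (_ , e) rewrite e = cong suc (mult-replicate m v)
... | inj₂ (v≢v , _) = ⊥-elim (v≢v refl)

mult-absent : ∀ w xs → All (λ x → x ≢ w) xs → mult w xs ≡ 0
mult-absent w [] [] = refl
mult-absent w (x ∷ xs) (x≢w ∷ ps) with equal-or-not x w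
... | inj₁ (x≡w , _) = ⊥-elim (x≢w x≡w)
... | inj₂ (_ , e) rewrite e = mult-absent w xs ps

mult-replicate-other : ∀ m v w → v ≢ w → mult w (replicate m v) ≡ 0
mult-replicate-other m v w v≢w = mult-absent w (replicate m v) (replicate⁺ m v≢w)

mult-≤-length : ∀ w xs → mult w xs ≤ length xs
mult-≤-length w [] = z≤n
mult-≤-length w (x ∷ xs) with equal-or-not x w
... | inj₁ (_ , e) rewrite e = s≤s (mult-≤-length w xs)
... | inj₂ (_ , e) rewrite e = m≤n⇒m≤1+n (mult-≤-length w xs)

-- every value i occurs fewer than i times (value v + 1 at most v times)
MultBounded : List ℕ → Set
MultBounded s = ∀ v → mult (suc v) s ≤ v

multBounded-++ˡ : ∀ xs ys → MultBounded (xs ++ ys) → MultBounded xs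
multBounded-++ˡ xs ys bound v = ≤-trans (subst (_ ≤_) (sym (mult-++ (suc v) xs ys)) (m≤m+n _ _)) (bound v)

multBounded-++ʳ : ∀ xs ys → MultBounded (xs ++ ys) → MultBounded ys
multBounded-++ʳ xs ys bound v = ≤-trans (subst (_ ≤_) (sym (mult-++ (suc v) xs ys)) (m≤n+m _ _)) (bound v)

-- Admissible sequences and their enumeration.

Admissible : ℕ → ℕ → List ℕ → Set
Admissible a c s = Sorted s × All (λ x → a ≤ x × x < a + c) s × MultBounded s

pad : ℕ → ℕ → List ℕ → List ℕ
pad m v s = s ++ replicate m v

padAll : ℕ → List ℕ → List (List ℕ) → List (List ℕ)
padAll v [] T = []
padAll v (m ∷ ms) T = map (pad m v) T ++ padAll v ms T

-- the admissible sequences with parts in [a, a + c): choose the admissible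
-- part above a, then the multiplicity m < a of the smallest value a
admissibles : ℕ → ℕ → List (List ℕ)
admissibles a zero = [] ∷ []
admissibles a (suc c) = padAll a (upTo a) (admissibles (suc a) c)

weight-pad : ∀ m v s → sum (pad m v s) ≡ m * v + sum s
weight-pad m v s =
  trans (sum-++ s (replicate m v)) (trans (cong (sum s +_) (sum-replicate m)) (+-comm (sum s) (m * v)))
  where
  sum-replicate : ∀ m → sum (replicate m v) ≡ m * v
  sum-replicate zero = refl
  sum-replicate (suc m) = cong (v +_) (sum-replicate m)

mult-pad : ∀ m v s → All (λ x → suc v ≤ x) s → mult v (pad m v s) ≡ m
mult-pad m v s above = begin
    mult v (s ++ replicate m v)        ≡⟨ mult-++ v s (replicate m v) ⟩
    mult v s + mult v (replicate m v)  ≡⟨ cong₂ _+_ (mult-absent v s v∉s) (mult-replicate m v) ⟩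
    m                                  ∎
  where
  open ≡-Reasoning
  v∉s = All.map (λ v<x v≡x → <-irrefl (sym v≡x) v<x) above

∈-padAll⁻ : ∀ {s} v ms T → s ∈ padAll v ms T → ∃ λ m → m ∈ ms × ∃ λ s' → s' ∈ T × s ≡ pad m v s'
∈-padAll⁻ v (m ∷ ms) T mem with ∈-++⁻ (map (pad m v) T) mem
... | inj₁ p with ∈-map⁻ (pad m v) p
...   | s' , s'∈ , eq = m , here refl , s' , s'∈ , eq
∈-padAll⁻ v (m ∷ ms) T mem | inj₂ p with ∈-padAll⁻ v ms T p
... | m' , m'∈ , s' , s'∈ , eq = m' , there m'∈ , s' , s'∈ , eq

∈-padAll⁺ : ∀ {m s'} v ms T → m ∈ ms → s' ∈ T → pad m v s' ∈ padAll v ms T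
∈-padAll⁺ v (m ∷ ms) T (here refl) s'∈ = ∈-++⁺ˡ (∈-map⁺ (pad m v) s'∈)
∈-padAll⁺ v (m ∷ ms) T (there m∈) s'∈ = ∈-++⁺ʳ (map (pad _ v) T) (∈-padAll⁺ v ms T m∈ s'∈)

pad-admissible : ∀ {m a c s} → m < a → Admissible (suc a) c s → Admissible a (suc c) (pad m a s)
pad-admissible {m} {a} {c} {s} m<a (sorted , range , bound) =
    sorted-++ sorted (sorted-replicate m a)
      (All.map (λ r → replicate⁺ m (≤-trans (n≤1+n a) (proj₁ r))) range)
  , ++⁺ (All.map (λ {x} r → ≤-trans (n≤1+n a) (proj₁ r) , subst (x <_) (sym (+-suc a c)) (proj₂ r)) range)
        (replicate⁺ m (≤-refl , subst (a <_) (sym (+-suc a c)) (s≤s (m≤m+n a c))))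
  , padded-bound
  where
  padded-bound : MultBounded (pad m a s)
  padded-bound v with suc v ≟ a
  ... | yes refl = subst (_≤ v) (sym (mult-pad m (suc v) s (All.map proj₁ range))) (≤-pred m<a)
  ... | no 1+v≢a = subst (_≤ v) (sym only-s) (bound v)
    where
    only-s : mult (suc v) (pad m a s) ≡ mult (suc v) s
    only-s = trans (mult-++ (suc v) s (replicate m a))
      (trans (cong (_ +_) (mult-replicate-other m a (suc v) (λ e → 1+v≢a (sym e)))) (+-identityʳ _))

admissibles-sound : ∀ a c s → s ∈ admissibles a c → Admissible a c s
admissibles-sound a zero .[] (here refl) = [] , [] , (λ v → z≤n)
admissibles-sound a (suc c) s mem with ∈-padAll⁻ a (upTo a) (admissibles (suc a) c) mem
... | m , m∈ , s' , s'∈ , refl = pad-admissible (∈-upTo⁻ m∈) (admissibles-sound (suc a) c s' s'∈)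

record Decomposition (a : ℕ) (s r : List ℕ) : Set₁ where
  field
    pad-eq   : s ≡ pad (mult a s) a r
    above    : All (λ x → suc a ≤ x) r
    sorted   : Sorted r
    inherits : ∀ {P : ℕ → Set} → All P s → All P r
    mult-≤   : ∀ w → mult w r ≤ mult w s

all-equal-replicate : ∀ a xs → All (λ y → y ≤ a) xs → All (λ y → a ≤ y) xs →
  xs ≡ replicate (mult a xs) a
all-equal-replicate a [] [] [] = refl
all-equal-replicate a (x ∷ xs) (p ∷ ps) (q ∷ qs) with equal-or-not x a
... | inj₁ (refl , e) rewrite e = cong (x ∷_) (all-equal-replicate a xs ps qs)
... | inj₂ (x≢a , _) = ⊥-elim (x≢a (≤-antisym p q))

decompose : ∀ a s → Sorted s → All (λ x → a ≤ x) s → ∃ λ r → Decomposition a s r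
decompose a [] _ _ =
  [] , record { pad-eq = refl ; above = [] ; sorted = [] ; inherits = λ _ → [] ; mult-≤ = λ w → z≤n }
decompose a (x ∷ xs) sorted (a≤x ∷ a≤xs) with equal-or-not x a
... | inj₁ (x≡a , e) = [] , record
  { pad-eq = all-a ; above = [] ; sorted = [] ; inherits = λ _ → [] ; mult-≤ = λ w → z≤n }
  where
  all-a : x ∷ xs ≡ pad (mult a (x ∷ xs)) a []
  all-a rewrite e =
    cong₂ _∷_ x≡a (all-equal-replicate a xs (subst (λ t → All (λ y → y ≤ t) xs) x≡a (sorted-bounded sorted))
                                            a≤xs)
... | inj₂ (x≢a , e) = x ∷ r , record
  { pad-eq = head-kept
  ; above = ≤∧≢⇒< a≤x (λ a≡x → x≢a (sym a≡x)) ∷ D.above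
  ; sorted = sorted-cons (D.inherits (sorted-bounded sorted)) D.sorted
  ; inherits = λ { (p ∷ ps) → p ∷ D.inherits ps }
  ; mult-≤ = λ w → +-monoʳ-≤ (indicator (does (x ≟ w))) (D.mult-≤ w) }
  where
  rest = decompose a xs (Linked.tail sorted) a≤xs
  r = proj₁ rest
  module D = Decomposition (proj₂ rest)
  head-kept : x ∷ xs ≡ pad (mult a (x ∷ xs)) a (x ∷ r)
  head-kept rewrite e = cong (x ∷_) D.pad-eq

-- every admissible sequence with parts ≥ 1 is enumerated: split off the copies
-- of the smallest allowed value and recurse on the part above it
admissibles-complete : ∀ b c s → Admissible (suc b) c s → s ∈ admissibles (suc b) c
admissibles-complete b zero [] _ = here refl
admissibles-complete b zero (x ∷ xs) (_ , (b<x , x<b+0) ∷ _ , _) =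
  ⊥-elim (<-irrefl refl (≤-trans x<b+0 (subst (_≤ x) (sym (+-identityʳ (suc b))) b<x)))
admissibles-complete b (suc c) s (sorted , range , bound) =
  subst (_∈ admissibles (suc b) (suc c)) (sym D.pad-eq)
    (∈-padAll⁺ (suc b) (upTo (suc b)) (admissibles (suc (suc b)) c) (∈-upTo⁺ (s≤s (bound b)))
      (admissibles-complete (suc b) c r r-admissible))
  where
  split = decompose (suc b) s sorted (All.map proj₁ range)
  r = proj₁ split
  module D = Decomposition (proj₂ split)
  r-admissible : Admissible (suc (suc b)) c r
  r-admissible = D.sorted
    , All.zipWith (λ { {x} (above , (_ , below)) → above , subst (x <_) (+-suc (suc b) c) below })
                  (D.above , D.inherits range)
    , (λ v → ≤-trans (D.mult-≤ (suc v)) (bound v))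

-- distinct multiplicities of v give distinct paddings, as v is below every part of T
padAll-unique : ∀ v ms T → Unique ms → Unique T → (∀ {s} → s ∈ T → All (λ x → suc v ≤ x) s) →
  Unique (padAll v ms T)
padAll-unique v [] T _ _ _ = []
padAll-unique v (m ∷ ms) T (m∉ms ∷ ms-unique) T-unique above =
  Unique.++⁺ (Unique.map⁺ (λ {x} {y} e → ++-cancelʳ (replicate m v) x y e) T-unique)
             (padAll-unique v ms T ms-unique T-unique above) disjoint
  where
  disjoint : ∀ {s} → ¬ (s ∈ map (pad m v) T × s ∈ padAll v ms T)
  disjoint (p , q) with ∈-map⁻ (pad m v) p | ∈-padAll⁻ v ms T q
  ... | s₁ , s₁∈ , refl | m' , m'∈ , s₂ , s₂∈ , eq =
    All.lookup m∉ms m'∈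
      (trans (sym (mult-pad m v s₁ (above s₁∈))) (trans (cong (mult v) eq) (mult-pad m' v s₂ (above s₂∈))))

admissibles-unique : ∀ a c → Unique (admissibles a c)
admissibles-unique a zero = [] ∷ []
admissibles-unique a (suc c) =
  padAll-unique a (upTo a) (admissibles (suc a) c) (Unique.upTo⁺ a) (admissibles-unique (suc a) c)
    (λ {s} mem → All.map proj₁ (proj₁ (proj₂ (admissibles-sound (suc a) c s mem))))

range : ℕ → ℕ → List ℕ
range a zero = []
range a (suc c) = a ∷ range (suc a) c

bracketProduct : ℕ → ℕ → Poly
bracketProduct a c = foldr (λ i p → qBracket i i *P p) (1 ∷ []) (range a c)

productFormula-range : ∀ n → productFormula n ≡ bracketProduct 1 n
productFormula-range n =
  cong (foldr (λ i p → qBracket i i *P p) (1 ∷ [])) (shifted-upTo (λ i → i) 1 n (λ i → refl))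
  where
  shifted-upTo : ∀ (g : ℕ → ℕ) a c → (∀ i → suc (g i) ≡ a + i) → map suc (applyUpTo g c) ≡ range a c
  shifted-upTo g a zero eq = refl
  shifted-upTo g a (suc c) eq = cong₂ _∷_ (trans (eq 0) (+-identityʳ a))
    (shifted-upTo (λ i → g (suc i)) (suc a) c (λ i → trans (eq (suc i)) (+-suc a i)))

padAll-count : ∀ v ms T k →
  countBy sum k (padAll v ms T) ≡ sum (map (λ j → shift (j * v) (λ k' → countBy sum k' T) k) ms)
padAll-count v [] T k = refl
padAll-count v (m ∷ ms) T k = begin
    countBy sum k (map (pad m v) T ++ padAll v ms T)
      ≡⟨ countBy-++ sum k (map (pad m v) T) (padAll v ms T) ⟩
    countBy sum k (map (pad m v) T) + countBy sum k (padAll v ms T)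
      ≡⟨ cong₂ _+_ (countBy-map sum (pad m v) k T) (padAll-count v ms T k) ⟩
    countBy (λ s → sum (pad m v s)) k T + sum (map (λ j → shift (j * v) (λ k' → countBy sum k' T) k) ms)
      ≡⟨ cong (_+ _) (countBy-shift (λ s → sum (pad m v s)) sum (m * v) (weight-pad m v) k T) ⟩
    shift (m * v) (λ k' → countBy sum k' T) k + sum (map (λ j → shift (j * v) (λ k' → countBy sum k' T) k) ms) ∎
  where open ≡-Reasoning

admissibles-count : ∀ a c k → countBy sum k (admissibles a c) ≡ coeff (bracketProduct a c) k
admissibles-count a zero zero = refl
admissibles-count a zero (suc k) = refl
admissibles-count a (suc c) k = begin
    countBy sum k (padAll a (upTo a) (admissibles (suc a) c))
      ≡⟨ padAll-count a (upTo a) (admissibles (suc a) c) k ⟩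
    sum (map (λ j → shift (j * a) (λ k' → countBy sum k' (admissibles (suc a) c)) k) (upTo a))
      ≡⟨ cong sum (map-cong (λ j → shift-cong (j * a) (admissibles-count (suc a) c) k) (upTo a)) ⟩
    sum (map (λ j → shift (j * a) (coeff (bracketProduct (suc a) c)) k) (upTo a))
      ≡⟨ sym (coeff-geometric*P a (upTo a) (bracketProduct (suc a) c) k) ⟩
    coeff (bracketProduct a (suc c)) k ∎
  where open ≡-Reasoning

-- Greedy cutting of a sequence into rows. The row currently being filled
-- holds k parts; the next part x continues it while k < x (so x is not special
-- at its position) and otherwise starts a new row.

_◂_ : ℕ → List (List ℕ) → List (List ℕ)
x ◂ [] = (x ∷ []) ∷ []
x ◂ (r ∷ rs) = (x ∷ r) ∷ rs

-- rowsFrom k s cuts s into rows, the first of which continues a row of k parts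
rowsFrom : ℕ → List ℕ → List (List ℕ)
rowsFrom k [] = [] ∷ []
rowsFrom k (x ∷ xs) = if does (k <? x) then x ◂ rowsFrom (suc k) xs else ([] ∷ (x ◂ rowsFrom 1 xs))

cut : List ℕ → List (List ℕ)
cut [] = []
cut (x ∷ xs) = x ◂ rowsFrom 1 xs

concat-◂ : ∀ x R → concat (x ◂ R) ≡ x ∷ concat R
concat-◂ x [] = refl
concat-◂ x (r ∷ rs) = refl

concat-rowsFrom : ∀ k s → concat (rowsFrom k s) ≡ s
concat-rowsFrom k [] = refl
concat-rowsFrom k (x ∷ xs) with less-or-not k x
... | inj₁ (_ , e) rewrite e = trans (concat-◂ x (rowsFrom (suc k) xs)) (cong (x ∷_) (concat-rowsFrom (suc k) xs))
... | inj₂ (_ , e) rewrite e = trans (concat-◂ x (rowsFrom 1 xs)) (cong (x ∷_) (concat-rowsFrom 1 xs))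

concat-cut : ∀ s → concat (cut s) ≡ s
concat-cut [] = refl
concat-cut (x ∷ xs) = trans (concat-◂ x (rowsFrom 1 xs)) (cong (x ∷_) (concat-rowsFrom 1 xs))

-- the row r, placed k columns to the right of the diagonal, has no special part
NoSpecialFrom : ℕ → List ℕ → Set
NoSpecialFrom k r = ∀ i y → At r i y → k + i < y

HeadAtMost : ℕ → List (List ℕ) → Set
HeadAtMost b [] = ⊤
HeadAtMost b ([] ∷ _) = ⊤
HeadAtMost b ((y ∷ _) ∷ _) = y ≤ b

-- rows as produced by greedy cutting: nonempty, without special parts, and
-- each row ends because the next part would be special
GreedyRows : List (List ℕ) → Set
GreedyRows [] = ⊤
GreedyRows ([] ∷ _) = ⊥
GreedyRows ((x ∷ xs) ∷ rest) =
  NoSpecialFrom 0 (x ∷ xs) × HeadAtMost (suc (length xs)) rest × GreedyRows rest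

GreedyFrom : ℕ → List (List ℕ) → Set
GreedyFrom k [] = ⊥
GreedyFrom k (r ∷ rest) = NoSpecialFrom k r × HeadAtMost (k + length r) rest × GreedyRows rest

NoSpecialFrom-cons : ∀ k x r → k < x → NoSpecialFrom (suc k) r → NoSpecialFrom k (x ∷ r)
NoSpecialFrom-cons k x r k<x ns .0 .x here = subst (_< x) (sym (+-identityʳ k)) k<x
NoSpecialFrom-cons k x r k<x ns (suc i) y (there a) = subst (_< y) (sym (+-suc k i)) (ns i y a)

NoSpecialFrom-tail : ∀ k x r → NoSpecialFrom k (x ∷ r) → NoSpecialFrom (suc k) r
NoSpecialFrom-tail k x r ns i y a = subst (_< y) (+-suc k i) (ns (suc i) y (there a))

◂-greedyFrom : ∀ k x R → k < x → GreedyFrom (suc k) R → GreedyFrom k (x ◂ R)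
◂-greedyFrom k x (r ∷ rest) k<x (ns , hd , gr) =
  NoSpecialFrom-cons k x r k<x ns , subst (λ b → HeadAtMost b rest) (sym (+-suc k (length r))) hd , gr

◂-greedy : ∀ x R → 0 < x → GreedyFrom 1 R → GreedyRows (x ◂ R)
◂-greedy x (r ∷ rest) 0<x (ns , hd , gr) = NoSpecialFrom-cons 0 x r 0<x ns , hd , gr

rowsFrom-greedy : ∀ k s → All (λ x → 1 ≤ x) s → GreedyFrom k (rowsFrom k s)
rowsFrom-greedy k [] [] = (λ i y ()) , tt , tt
rowsFrom-greedy k (x ∷ xs) (0<x ∷ pos) with less-or-not k x
... | inj₁ (k<x , e) rewrite e = ◂-greedyFrom k x (rowsFrom (suc k) xs) k<x (rowsFrom-greedy (suc k) xs pos)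
... | inj₂ (k≮x , e) rewrite e =
  (λ i y ()) , new-row-head (rowsFrom 1 xs) rest-greedy , ◂-greedy x (rowsFrom 1 xs) 0<x rest-greedy
  where
  rest-greedy = rowsFrom-greedy 1 xs pos
  new-row-head : ∀ R → GreedyFrom 1 R → HeadAtMost (k + 0) (x ◂ R)
  new-row-head (r ∷ rest) _ = subst (x ≤_) (sym (+-identityʳ k)) (≮⇒≥ k≮x)

cut-greedy : ∀ s → All (λ x → 1 ≤ x) s → GreedyRows (cut s)
cut-greedy [] [] = tt
cut-greedy (x ∷ xs) (0<x ∷ pos) = ◂-greedy x (rowsFrom 1 xs) 0<x (rowsFrom-greedy 1 xs pos)

rowsFrom-concat : ∀ k r rest → NoSpecialFrom k r → HeadAtMost (k + length r) rest → GreedyRows rest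
                → rowsFrom k (r ++ concat rest) ≡ r ∷ rest
rowsFrom-concat k [] [] ns hd gr = refl
rowsFrom-concat k [] ([] ∷ rest) ns hd ()
rowsFrom-concat k [] ((y ∷ ys) ∷ rest) ns hd (ns' , hd' , gr') with less-or-not k y
... | inj₁ (k<y , _) = ⊥-elim (<-irrefl refl (≤-trans k<y (subst (y ≤_) (+-identityʳ k) hd)))
... | inj₂ (_ , e) rewrite e =
  cong (λ R → [] ∷ (y ◂ R)) (rowsFrom-concat 1 ys rest (NoSpecialFrom-tail 0 y ys ns') hd' gr')
rowsFrom-concat k (x ∷ r) rest ns hd gr with less-or-not k x
... | inj₁ (_ , e) rewrite e =
  cong (x ◂_) (rowsFrom-concat (suc k) r rest (NoSpecialFrom-tail k x r ns)
                 (subst (λ b → HeadAtMost b rest) (+-suc k (length r)) hd) gr)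
... | inj₂ (k≮x , _) = ⊥-elim (k≮x (subst (_< x) (+-identityʳ k) (ns 0 x here)))

cut-concat : ∀ d → GreedyRows d → cut (concat d) ≡ d
cut-concat [] _ = refl
cut-concat ((x ∷ xs) ∷ rest) (ns , hd , gr) =
  cong (x ◂_) (rowsFrom-concat 1 xs rest (NoSpecialFrom-tail 0 x xs ns) hd gr)

All-At : ∀ {P : ℕ → Set} {r i x} → All P r → At r i x → P x
All-At (p ∷ _) here = p
All-At (_ ∷ ps) (there a) = All-At ps a

At-exists : ∀ r i → i < length r → ∃ λ x → At r i x
At-exists (x ∷ r) zero _ = x , here
At-exists (x ∷ r) (suc i) (s≤s i<len) with At-exists r i i<len
... | y , a = y , there a

At-length : ∀ {r i x} → At r i x → i < length r
At-length here = s≤s z≤n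
At-length (there a) = s≤s (At-length a)

sorted-At : ∀ {xs i j a b} → Sorted xs → At xs i a → At xs j b → i ≤ j → b ≤ a
sorted-At s here here _ = ≤-refl
sorted-At s here (there bj) _ = All-At (sorted-bounded s) bj
sorted-At s (there ai) (there bj) (s≤s i≤j) = sorted-At (Linked.tail s) ai bj i≤j

sorted-++⁻ˡ : ∀ xs {ys} → Sorted (xs ++ ys) → Sorted xs
sorted-++⁻ˡ [] _ = []
sorted-++⁻ˡ (x ∷ []) _ = [-]
sorted-++⁻ˡ (x ∷ y ∷ xs) (p ∷ q) = p ∷ sorted-++⁻ˡ (y ∷ xs) q

sorted-++⁻ʳ : ∀ xs {ys} → Sorted (xs ++ ys) → Sorted ys
sorted-++⁻ʳ [] p = p
sorted-++⁻ʳ (x ∷ xs) p = sorted-++⁻ʳ xs (Linked.tail p)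

maxPart-upper : ∀ r → All (λ x → x ≤ maxPart r) r
maxPart-upper [] = []
maxPart-upper (x ∷ r) =
  m≤m⊔n x (maxPart r) ∷ All.map (λ p → ≤-trans p (m≤n⊔m x (maxPart r))) (maxPart-upper r)

maxPart-least : ∀ {b} r → All (λ x → x ≤ b) r → maxPart r ≤ b
maxPart-least [] [] = z≤n
maxPart-least (x ∷ r) (p ∷ ps) = ⊔-lub p (maxPart-least r ps)

maxPart-sorted : ∀ y ys → Sorted (y ∷ ys) → maxPart (y ∷ ys) ≡ y
maxPart-sorted y ys s = m≥n⇒m⊔n≡m (maxPart-least ys (sorted-bounded s))

-- a weakly decreasing row at offset o without special parts has all parts
-- at least o + its length (its last part exceeds o + length - 1)
parts-≥-length : ∀ o r → Sorted r → NoSpecialFrom o r → All (λ x → o + length r ≤ x) r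
parts-≥-length o [] _ _ = []
parts-≥-length o (x ∷ []) s ns = subst (_≤ x) (sym (+-suc o 0)) (ns 0 x here) ∷ []
parts-≥-length o (x ∷ y ∷ ys) s ns
  with parts-≥-length (suc o) (y ∷ ys) (Linked.tail s) (NoSpecialFrom-tail o x (y ∷ ys) ns)
... | rest@(o+len≤y ∷ _) =
  subst (_≤ x) (sym (+-suc o _)) (≤-trans o+len≤y (Linked.head s))
  ∷ All.map (λ {z} p → subst (_≤ z) (sym (+-suc o (length (y ∷ ys)))) p) rest

mult-all-equal : ∀ v xs → All (λ y → y ≡ v) xs → mult v xs ≡ length xs
mult-all-equal v [] [] = refl
mult-all-equal v (x ∷ xs) (p ∷ ps) with equal-or-not x v
... | inj₁ (_ , e) rewrite e = cong suc (mult-all-equal v xs ps)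
... | inj₂ (x≢v , _) = ⊥-elim (x≢v p)

mult-suffix : ∀ v xs j → (∀ i z → At xs i z → j ≤ i → z ≡ v) → length xs ∸ j ≤ mult v xs
mult-suffix v [] j _ = subst (_≤ 0) (sym (0∸n≡0 j)) z≤n
mult-suffix v (x ∷ xs) zero eqv with equal-or-not x v
... | inj₁ (_ , e) rewrite e = s≤s (mult-suffix v xs 0 (λ i z a _ → eqv (suc i) z (there a) z≤n))
... | inj₂ (x≢v , _) = ⊥-elim (x≢v (eqv 0 x here z≤n))
mult-suffix v (x ∷ xs) (suc j) eqv =
  ≤-trans (mult-suffix v xs j (λ i z a j≤i → eqv (suc i) z (there a) (s≤s j≤i)))
          (m≤n+m (mult v xs) (indicator (does (x ≟ v))))

mult-prefix : ∀ v xs k → (∀ i z → At xs i z → i ≤ k → z ≡ v) → k < length xs → suc k ≤ mult v xs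
mult-prefix v (x ∷ xs) k eqv k<len with equal-or-not x v
... | inj₂ (x≢v , _) = ⊥-elim (x≢v (eqv 0 x here z≤n))
... | inj₁ (_ , e) rewrite e with k
...   | zero = s≤s z≤n
...   | suc k' =
  s≤s (mult-prefix v xs k' (λ i z a i≤k' → eqv (suc i) z (there a) (s≤s i≤k')) (≤-pred k<len))

mult-< : ∀ s → MultBounded s → ∀ {v} → 0 < v → mult v s < v
mult-< s bound {suc v} _ = s≤s (bound v)

-- Greedy rows of an admissible sequence satisfy the DPP conditions.

-- a row without special parts is shorter than its first part, since otherwise
-- all its parts equal its length L and L occurs L times
greedy-row-short : ∀ x xs → NoSpecialFrom 0 (x ∷ xs) → Sorted (x ∷ xs) → MultBounded (x ∷ xs) →
  length (x ∷ xs) < x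
greedy-row-short x xs ns sorted bound with length (x ∷ xs) <? x
... | yes short = short
... | no ¬short = ⊥-elim (<-irrefl refl (<-≤-trans (mult-< (x ∷ xs) bound 0<x) too-many))
  where
  r = x ∷ xs
  0<x = ns 0 x here
  x≤len = ≮⇒≥ ¬short
  all-x : All (λ y → y ≡ x) r
  all-x = All.zipWith (λ { (y≤x , len≤y) → ≤-antisym y≤x (≤-trans x≤len len≤y) })
                      ((≤-refl ∷ sorted-bounded sorted) , parts-≥-length 0 r sorted ns)
  too-many : x ≤ mult x r
  too-many = ≤-trans x≤len (≤-reflexive (sym (mult-all-equal x r all-x)))

greedy-row-ok : ∀ x xs → NoSpecialFrom 0 (x ∷ xs) → Sorted (x ∷ xs) → All (λ y → 1 ≤ y) (x ∷ xs)
              → MultBounded (x ∷ xs) → RowOK (x ∷ xs)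
greedy-row-ok x xs ns sorted pos bound = record
  { nonempty = s≤s z≤n ; positive = pos ; weaklyDecr = sorted
  ; lenLtMax = subst (length (x ∷ xs) <_) (sym (maxPart-sorted x xs sorted))
                     (greedy-row-short x xs ns sorted bound) }

-- Column strictness: if a part z of the next row were at least the part x above
-- it, then x, the parts after it, and the parts of the next row up to z would all
-- equal the length L of the upper row, giving at least L copies of L.
greedy-column-strict : ∀ {r r'} k x z → NoSpecialFrom 0 r → Sorted r → Sorted r'
  → All (λ y → y ≤ length r) r' → MultBounded (r ++ r') → At r (suc k) x → At r' k z → z < x
greedy-column-strict {r} {r'} k x z ns sorted sorted' r'≤L bound ax az with z <? x
... | yes z<x = z<x
... | no z≮x = ⊥-elim (<-irrefl refl (<-≤-trans (mult-< (r ++ r') bound 0<L) L-copies))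
  where
  L = length r
  x≤z = ≮⇒≥ z≮x
  0<L : 0 < L
  0<L = ≤-trans (s≤s z≤n) (At-length ax)
  L≤r : All (λ y → L ≤ y) r
  L≤r = parts-≥-length 0 r sorted ns
  after-x : ∀ i t → At r i t → suc k ≤ i → t ≡ L
  after-x i t at k<i =
    ≤-antisym (≤-trans (sorted-At sorted ax at k<i) (≤-trans x≤z (All-At r'≤L az))) (All-At L≤r at)
  up-to-z : ∀ i t → At r' i t → i ≤ k → t ≡ L
  up-to-z i t at i≤k =
    ≤-antisym (All-At r'≤L at) (≤-trans (All-At L≤r ax) (≤-trans x≤z (sorted-At sorted' at az i≤k)))
  L-copies : L ≤ mult L (r ++ r')
  L-copies = subst (L ≤_) (sym (mult-++ L r r'))
    (subst (_≤ mult L r + mult L r') (m∸n+n≡m (<⇒≤ (At-length ax)))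
      (+-mono-≤ (mult-suffix L r (suc k) after-x) (mult-prefix L r' k up-to-z (At-length az))))

-- consecutive greedy rows satisfy the conditions between rows; the bound on the
-- next row's largest part is the greedy break condition
greedy-next-ok : ∀ r y ys → NoSpecialFrom 0 r → Sorted r → RowOK (y ∷ ys) → y ≤ length r
               → MultBounded (r ++ (y ∷ ys)) → NextRowOK r (y ∷ ys)
greedy-next-ok r y ys ns sorted row-ok y≤L bound = record
  { shifted = <-≤-trans (RowOK.lenLtMax row-ok) max≤L
  ; colStrict = λ k x z → greedy-column-strict k x z ns sorted sorted' below bound
  ; maxNextLeLen = max≤L }
  where
  sorted' = RowOK.weaklyDecr row-ok
  max≤L : maxPart (y ∷ ys) ≤ length r
  max≤L = subst (_≤ length r) (sym (maxPart-sorted y ys sorted')) y≤L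
  below : All (λ t → t ≤ length r) (y ∷ ys)
  below = All.map (λ t≤y → ≤-trans t≤y y≤L) (≤-refl ∷ sorted-bounded sorted')

greedy-dpp : ∀ d → GreedyRows d → Sorted (concat d) → All (λ x → 1 ≤ x) (concat d) → MultBounded (concat d) →
  IsDPP d
greedy-dpp [] _ _ _ _ = [] , []
greedy-dpp ((x ∷ xs) ∷ rest) (ns , hd , gr) sorted pos bound =
  row-ok ∷ proj₁ rest-dpp , link-first rest hd (proj₁ rest-dpp) bound (proj₂ rest-dpp)
  where
  r = x ∷ xs
  sorted-r = sorted-++⁻ˡ r sorted
  row-ok = greedy-row-ok x xs ns sorted-r (++⁻ˡ r pos) (multBounded-++ˡ r _ bound)
  rest-dpp = greedy-dpp rest gr (sorted-++⁻ʳ r sorted) (++⁻ʳ r pos) (multBounded-++ʳ r _ bound)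
  link-first : ∀ rest → HeadAtMost (length r) rest → All RowOK rest → MultBounded (r ++ concat rest)
             → Linked NextRowOK rest → Linked NextRowOK (r ∷ rest)
  link-first [] _ _ _ _ = [-]
  link-first ([] ∷ _) _ (empty-ok ∷ _) _ _ = ⊥-elim (<-irrefl refl (RowOK.nonempty empty-ok))
  link-first ((y ∷ ys) ∷ rest') y≤L (row-ok' ∷ _) bound' linked =
    greedy-next-ok r y ys ns sorted-r row-ok' y≤L
      (multBounded-++ˡ (r ++ y ∷ ys) (concat rest')
        (subst MultBounded (sym (++-assoc r (y ∷ ys) (concat rest'))) bound'))
    ∷ linked

SpecialFreeDPP : List (List ℕ) → Set
SpecialFreeDPP d = IsDPP d × NoSpecialParts d

special-free-tail : ∀ {r rest} → SpecialFreeDPP (r ∷ rest) → SpecialFreeDPP rest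
special-free-tail ((_ ∷ rows , linked) , _ ∷ ns) = (rows , Linked.tail linked) , ns

first-row-sorted : ∀ {r rest} → SpecialFreeDPP (r ∷ rest) → Sorted r
first-row-sorted ((row ∷ _ , _) , _) = RowOK.weaklyDecr row

first-row-no-special : ∀ {r rest} → SpecialFreeDPP (r ∷ rest) → NoSpecialFrom 0 r
first-row-no-special (_ , ns ∷ _) = ns

dpp-greedy : ∀ d → SpecialFreeDPP d → GreedyRows d
dpp-greedy [] _ = tt
dpp-greedy ([] ∷ rest) ((row ∷ _ , _) , _) = ⊥-elim (<-irrefl refl (RowOK.nonempty row))
dpp-greedy ((x ∷ xs) ∷ rest) dpp@((_ , linked) , ns ∷ _) =
  ns , next-head rest linked , dpp-greedy rest (special-free-tail dpp)
  where
  next-head : ∀ rest → Linked NextRowOK ((x ∷ xs) ∷ rest) → HeadAtMost (suc (length xs)) rest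
  next-head [] _ = tt
  next-head ([] ∷ _) _ = tt
  next-head ((y ∷ ys) ∷ _) (next ∷ _) = ≤-trans (All-At (maxPart-upper (y ∷ ys)) here) (NextRowOK.maxNextLeLen next)

below-≤-length : ∀ r rest → SpecialFreeDPP (r ∷ rest) → All (λ x → x ≤ length r) (concat rest)
below-≤-length r [] _ = []
below-≤-length r (r' ∷ rest) dpp@((_ , next ∷ _) , _) =
  ++⁺ (All.map (λ p → ≤-trans p (NextRowOK.maxNextLeLen next)) (maxPart-upper r'))
      (All.map (λ p → ≤-trans p (<⇒≤ (NextRowOK.shifted next)))
               (below-≤-length r' rest (special-free-tail dpp)))

concat-sorted : ∀ d → SpecialFreeDPP d → Sorted (concat d)
concat-sorted [] _ = []
concat-sorted (r ∷ rest) dpp =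
  sorted-++ (first-row-sorted dpp) (concat-sorted rest (special-free-tail dpp))
    (All.map (λ L≤x → All.map (λ y≤L → ≤-trans y≤L L≤x) (below-≤-length r rest dpp))
             (parts-≥-length 0 r (first-row-sorted dpp) (first-row-no-special dpp)))

-- The multiplicity bound for a DPP without special parts. It is proved row by
-- row, comparing the copies of w with the number of parts greater than w.

zero-or-positive : ∀ n → n ≡ 0 ⊎ 0 < n
zero-or-positive zero = inj₁ refl
zero-or-positive (suc n) = inj₂ (s≤s z≤n)

suc-pred-positive : ∀ {n} → 0 < n → suc (pred n) ≡ n
suc-pred-positive {n} pos = suc-pred n {{>-nonZero pos}}

#above : ℕ → List ℕ → ℕ
#above w [] = 0
#above w (x ∷ xs) = indicator (does (w <? x)) + #above w xs

#above-zero⁻ : ∀ w r → #above w r ≡ 0 → All (λ x → x ≤ w) r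
#above-zero⁻ w [] _ = []
#above-zero⁻ w (x ∷ xs) none with less-or-not w x
... | inj₁ (_ , e) rewrite e = ⊥-elim (1+n≢0 none)
... | inj₂ (w≮x , e) rewrite e = ≮⇒≥ w≮x ∷ #above-zero⁻ w xs none

#above-zero⁺ : ∀ w r → All (λ x → x ≤ w) r → #above w r ≡ 0
#above-zero⁺ w [] [] = refl
#above-zero⁺ w (x ∷ xs) (x≤w ∷ ps) with less-or-not w x
... | inj₁ (w<x , _) = ⊥-elim (<-irrefl refl (<-≤-trans w<x x≤w))
... | inj₂ (_ , e) rewrite e = #above-zero⁺ w xs ps

#above-At : ∀ w {r i x} → Sorted r → At r i x → w < x → suc i ≤ #above w r
#above-At w {x ∷ xs} sorted here w<x with less-or-not w x
... | inj₁ (_ , e) rewrite e = s≤s z≤n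
... | inj₂ (w≮x , _) = ⊥-elim (w≮x w<x)
#above-At w {y ∷ xs} sorted (there a) w<x with less-or-not w y
... | inj₁ (_ , e) rewrite e = s≤s (#above-At w (Linked.tail sorted) a w<x)
... | inj₂ (w≮y , _) = ⊥-elim (w≮y (<-≤-trans w<x (All-At (sorted-bounded sorted) a)))

All-mult : ∀ {P : ℕ → Set} w xs → All P xs → 0 < mult w xs → P w
All-mult w (x ∷ xs) (p ∷ ps) present with equal-or-not x w
... | inj₁ (refl , _) = p
... | inj₂ (_ , e) rewrite e = All-mult w xs ps present

mult-below : ∀ w xs → All (λ y → y < w) xs → mult w xs ≡ 0
mult-below w xs below = mult-absent w xs (All.map (λ y<w y≡w → <-irrefl y≡w y<w) below)

-- in a weakly decreasing row at offset o without special parts, the parts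
-- above w followed by the copies of w fit before column w
row-occupancy : ∀ o w r → Sorted r → NoSpecialFrom o r → 0 < mult w r → o + (mult w r + #above w r) ≤ w
row-occupancy o w (x ∷ xs) sorted ns present with <-cmp x w
... | tri< x<w _ _ =
  ⊥-elim (<-irrefl (sym (mult-below w (x ∷ xs) all-below)) present)
  where
  all-below = x<w ∷ All.map (λ y≤x → ≤-<-trans y≤x x<w) (sorted-bounded sorted)
... | tri≈ _ refl _ with equal-or-not x x | less-or-not x x
...   | inj₂ (x≢x , _) | _ = ⊥-elim (x≢x refl)
...   | _ | inj₁ (x<x , _) = ⊥-elim (<-irrefl refl x<x)
...   | inj₁ (_ , e) | inj₂ (_ , e′)
  rewrite e | e′ | #above-zero⁺ x xs (sorted-bounded sorted) with zero-or-positive (mult x xs)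
...     | inj₁ none rewrite none = subst (_≤ x) (sym (+-suc o 0)) (ns 0 x here)
...     | inj₂ more = subst (_≤ x) (sym (+-suc o _))
  (subst (λ g → suc o + (mult x xs + g) ≤ x) (#above-zero⁺ x xs (sorted-bounded sorted))
    (row-occupancy (suc o) x xs (Linked.tail sorted) (NoSpecialFrom-tail o x xs ns) more))
row-occupancy o w (x ∷ xs) sorted ns present | tri> _ _ w<x with equal-or-not x w | less-or-not w x
... | inj₁ (refl , _) | _ = ⊥-elim (<-irrefl refl w<x)
... | _ | inj₂ (w≮x , _) = ⊥-elim (w≮x w<x)
... | inj₂ (_ , e) | inj₁ (_ , e′) rewrite e | e′ =
  subst (_≤ w) (trans (sym (+-suc o _)) (cong (o +_) (sym (+-suc (mult w xs) (#above w xs)))))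
    (row-occupancy (suc o) w xs (Linked.tail sorted) (NoSpecialFrom-tail o x xs ns) present)

last-copy-At : ∀ w xs → Sorted xs → All (λ y → y ≤ w) xs → 0 < mult w xs → At xs (pred (mult w xs)) w
last-copy-At w (x ∷ xs) sorted (x≤w ∷ ps) present with equal-or-not x w
... | inj₁ (x≡w , e) rewrite e with zero-or-positive (mult w xs)
...   | inj₁ none rewrite none = subst (At (x ∷ xs) 0) x≡w here
...   | inj₂ more = subst (λ i → At (x ∷ xs) i w) (suc-pred-positive more)
                      (there (last-copy-At w xs (Linked.tail sorted) ps more))
last-copy-At w (x ∷ xs) sorted (x≤w ∷ ps) present | inj₂ (x≢w , e) rewrite e =
  ⊥-elim (<-irrefl (sym (mult-below w xs all-below)) present)
  where
  all-below = All.map (λ y≤x → ≤-<-trans y≤x (≤∧≢⇒< x≤w x≢w)) (sorted-bounded sorted)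

-- if w occurs in the first row r and below it, the copies below all lie at the
-- start of the next row r', and the part of r above the last of them exceeds w;
-- so they are fewer than the parts of r greater than w
copies-below : ∀ w r r' rest → SpecialFreeDPP (r ∷ r' ∷ rest) → 0 < mult w r →
  0 < mult w (r' ++ concat rest) → mult w (r' ++ concat rest) < #above w r
copies-below w r r' rest dpp@((_ ∷ row' ∷ _ , next ∷ _) , _) in-r below
  with zero-or-positive (mult w (concat rest))
... | inj₂ in-rest = ⊥-elim (<-irrefl refl (<-≤-trans (RowOK.lenLtMax row')
        (≤-trans (NextRowOK.maxNextLeLen next)
          (≤-trans L≤w (All-mult w (concat rest) (below-≤-length r' rest (special-free-tail dpp)) in-rest)))))
  where
  L≤w = All-mult w r (parts-≥-length 0 r (first-row-sorted dpp) (first-row-no-special dpp)) in-r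
... | inj₁ none-in-rest = subst (_< #above w r) (sym only-r') c'<above
  where
  L≤w = All-mult w r (parts-≥-length 0 r (first-row-sorted dpp) (first-row-no-special dpp)) in-r
  only-r' : mult w (r' ++ concat rest) ≡ mult w r'
  only-r' = trans (mult-++ w r' (concat rest)) (trans (cong (mult w r' +_) none-in-rest) (+-identityʳ _))
  c' = mult w r'
  in-r' : 0 < c'
  in-r' = subst (0 <_) only-r' below
  r'≤w : All (λ x → x ≤ w) r'
  r'≤w = All.map (λ p → ≤-trans p L≤w) (++⁻ˡ r' (below-≤-length r (r' ∷ rest) dpp))
  last-w : At r' (pred c') w
  last-w = last-copy-At w r' (RowOK.weaklyDecr row') r'≤w in-r'
  c'<L : suc (pred c') < length r
  c'<L = subst (_< length r) (sym (suc-pred-positive in-r'))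
                (≤-<-trans (mult-≤-length w r') (NextRowOK.shifted next))
  above-last = At-exists r (suc (pred c')) c'<L
  w<above : w < proj₁ above-last
  w<above = NextRowOK.colStrict next (pred c') (proj₁ above-last) w (proj₂ above-last) last-w
  c'<above : c' < #above w r
  c'<above = subst (λ t → suc t ≤ #above w r) (suc-pred-positive in-r')
                    (#above-At w (first-row-sorted dpp) (proj₂ above-last) w<above)

row-multBounded : ∀ r → RowOK r → NoSpecialFrom 0 r → MultBounded r
row-multBounded r row ns v with zero-or-positive (mult (suc v) r)
... | inj₁ none = subst (_≤ v) (sym none) z≤n
... | inj₂ present with zero-or-positive (#above (suc v) r)
...   | inj₁ none-above = ≤-pred (≤-<-trans (mult-≤-length (suc v) r)
          (<-≤-trans (RowOK.lenLtMax row) (maxPart-least r (#above-zero⁻ (suc v) r none-above))))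
...   | inj₂ some-above = ≤-pred (<-≤-trans (m<m+n (mult (suc v) r) some-above)
          (row-occupancy 0 (suc v) r (RowOK.weaklyDecr row) ns present))

-- a DPP without special parts satisfies the multiplicity bound: copies of w
-- in a row and below it together fit before column w of that row
dpp-multBounded : ∀ d → SpecialFreeDPP d → MultBounded (concat d)
dpp-multBounded [] _ v = z≤n
dpp-multBounded (r ∷ rest) dpp v = subst (_≤ v) (sym (mult-++ (suc v) r (concat rest))) (split rest dpp)
  where
  w = suc v
  split : ∀ rest → SpecialFreeDPP (r ∷ rest) → mult w r + mult w (concat rest) ≤ v
  split rest dpp@((row ∷ _ , _) , ns ∷ _)
    with zero-or-positive (mult w r) | zero-or-positive (mult w (concat rest))
  ... | inj₁ none-in-r | _ =
    subst (λ m → m + _ ≤ v) (sym none-in-r) (dpp-multBounded rest (special-free-tail dpp) v)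
  ... | inj₂ _ | inj₁ none-below = subst (λ m → mult w r + m ≤ v) (sym none-below)
          (subst (_≤ v) (sym (+-identityʳ _)) (row-multBounded r row ns v))
  split [] _ | inj₂ _ | inj₂ ()
  split (r' ∷ rest') dpp | inj₂ in-r | inj₂ below =
    ≤-pred (<-≤-trans (+-monoʳ-< (mult w r) (copies-below w r r' rest' dpp in-r below))
                      (row-occupancy 0 w r (first-row-sorted dpp) (first-row-no-special dpp) in-r))

-- The correspondence between DPPs and admissible sequences.

greedy-no-special : ∀ d → GreedyRows d → NoSpecialParts d
greedy-no-special [] _ = []
greedy-no-special ([] ∷ rest) ()
greedy-no-special ((x ∷ xs) ∷ rest) (ns , _ , greedy) = ns ∷ greedy-no-special rest greedy

greedy-admissible-dpp : ∀ n d → GreedyRows d → Admissible 1 n (concat d)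
                      → IsDPP d × HasOrder n d × NoSpecialParts d
greedy-admissible-dpp n d greedy (sorted , range , bound) =
    greedy-dpp d greedy sorted (All.map proj₁ range) bound
  , concat⁻ (All.map (λ p → ≤-pred (proj₂ p)) range)
  , greedy-no-special d greedy

dpp-admissible : ∀ n d → IsDPP d × HasOrder n d × NoSpecialParts d → Admissible 1 n (concat d)
dpp-admissible n d ((rows , linked) , order , ns) =
    concat-sorted d dpp
  , All.zipWith (λ { (1≤x , x≤n) → 1≤x , s≤s x≤n }) (concat⁺ (All.map RowOK.positive rows) , concat⁺ order)
  , dpp-multBounded d dpp
  where
  dpp = (rows , linked) , ns

weight-cut : ∀ s → weight (cut s) ≡ sum s
weight-cut s = trans (weight-concat (cut s)) (cong sum (concat-cut s))
  where
  weight-concat : ∀ d → weight d ≡ sum (concat d)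
  weight-concat [] = refl
  weight-concat (r ∷ rest) = trans (cong (sum r +_) (weight-concat rest)) (sym (sum-++ r (concat rest)))

-- The DPPs of order n without special parts are the greedy cuttings of the
-- admissible sequences with parts in [1, n]; cutting preserves the weight.
-- (The argument does not need the hypothesis 1 ≤ n.)
corollary2p2 : (n : ℕ) → 1 ≤ n →
    ∃ λ (L : List (List (List ℕ))) →
    Unique L
    × (∀ d → d ∈ L ⇔ (IsDPP d × HasOrder n d × NoSpecialParts d))
    × (∀ k → countWeight L k ≡ coeff (productFormula n) k)
corollary2p2 n _ = map cut (admissibles 1 n) , unique , (λ d → mk⇔ (sound d) (complete d)) , count
  where
  unique : Unique (map cut (admissibles 1 n))
  unique = Unique.map⁺ (λ {s} {t} eq → trans (sym (concat-cut s)) (trans (cong concat eq) (concat-cut t)))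
                       (admissibles-unique 1 n)
  sound : ∀ d → d ∈ map cut (admissibles 1 n) → IsDPP d × HasOrder n d × NoSpecialParts d
  sound d mem with ∈-map⁻ cut mem
  ... | s , s∈ , refl =
    greedy-admissible-dpp n (cut s) (cut-greedy s (All.map proj₁ (proj₁ (proj₂ admissible))))
                          (subst (Admissible 1 n) (sym (concat-cut s)) admissible)
    where
    admissible = admissibles-sound 1 n s s∈
  complete : ∀ d → IsDPP d × HasOrder n d × NoSpecialParts d → d ∈ map cut (admissibles 1 n)
  complete d dpp@(is-dpp , _ , ns) =
    subst (_∈ map cut (admissibles 1 n)) (cut-concat d (dpp-greedy d (is-dpp , ns)))
          (∈-map⁺ cut (admissibles-complete 0 n (concat d) (dpp-admissible n d dpp)))
  count : ∀ k → countWeight (map cut (admissibles 1 n)) k ≡ coeff (productFormula n) k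
  count k = begin
      countBy weight k (map cut (admissibles 1 n))      ≡⟨ countBy-map weight cut k (admissibles 1 n) ⟩
      countBy (λ s → weight (cut s)) k (admissibles 1 n) ≡⟨ countBy-cong weight-cut k (admissibles 1 n) ⟩
      countBy sum k (admissibles 1 n)                   ≡⟨ admissibles-count 1 n k ⟩
      coeff (bracketProduct 1 n) k                      ≡⟨ cong (λ p → coeff p k) (sym (productFormula-range n)) ⟩
      coeff (productFormula n) k                        ∎
    where open ≡-Reasoning
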